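{- Let $G$ be a graph with a twin cover $M=\{v_1,\dots,v_k\}$, let $Q_1,\dots,Q_q$ be the connected components of $G-M$, and assume no $Q_i$ is isolated. Let $\chi^S$ be a partial CD coloring of $G$ with $M\subseteq S$, let $\ell'=|\mathrm{im}(\chi^S)|$, let $b_i$ be the number of vertices of $Q_i$ not in $S$, $\mathbf{b}=(b_1,\dots,b_q)^T$, and let $A$ be the $q\times k$ matrix with $A(i,j)=1$ if $v_j\in N_G[Q_i]$ and $0$ otherwise. Let $\ell^*$ be the optimal value of the integer program $\min\{\mathbf{1}_k\cdot\mathbf{x} : A\mathbf{x}\ge\mathbf{b},\ \mathbf{x}\in\mathbb{Z}^k,\ \mathbf{x}\ge 0\}$. Then for every $\ell\in\mathbb{N}$, there exists a disjoint extension $\chi$ of $\chi^S$ with $|\chi|\le\ell$ if and only if $\ell^*\le\ell-\ell'$.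
   Context: Graphs are finite and simple; $N_G[v]=N_G(v)\cup\{v\}$. A set $M\subseteq V(G)$ is a twin cover if for every edge $uv$ either $u\in M$ or $v\in M$, or $N_G[u]=N_G[v]$; then each component $Q$ of $G-M$ is a clique whose vertices all have the same closed neighborhood, denoted $N_G[Q]$, and $Q$ is isolated if $N_G[Q]\cap M=\emptyset$. $\mathbf{1}_k$ is the all-ones vector in $\mathbb{R}^k$. A proper coloring assigns different colors to adjacent vertices; $|\chi|$ is the number of colors used. A vertex $v$ dominates $T$ if $T\subseteq N_G[v]$. A CD coloring is a proper coloring of $G$ in which every color class is dominated by some vertex. A partial CD coloring is a map $\chi^S:S\to C$ ($S\subseteq V(G)$) that properly colors $G[S]$ and whose every color class is dominated by some vertex of $G$. A CD coloring $\chi$ is a disjoint extension of $\chi^S$ if it agrees with $\chi^S$ on $S$ and no vertex outside $S$ gets a color of $\mathrm{im}(\chi^S)$. -}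

module Defs where

open import Data.Nat using (ℕ; zero; suc; _+_; _*_; _≤_)
import Data.Nat as ℕ
open import Data.Bool using (Bool; true; false; T; not; _∧_; _∨_; if_then_else_)
open import Data.Fin using (Fin; zero; suc)
import Data.Fin as Fin
open import Data.List using (List; []; _∷_; map; length; deduplicate; filter; allFin)
open import Data.Product using (Σ; ∃; ∃-syntax; _×_; _,_)
open import Data.Sum using (_⊎_)
open import Relation.Nullary using (¬_)
open import Relation.Nullary.Decidable using (⌊_⌋)
open import Relation.Binary.PropositionalEquality using (_≡_; _≢_)
open import Function.Bundles using (_⇔_)

record Graph (n : ℕ) : Set where
  field
    adj    : Fin n → Fin n → Bool
    sym    : ∀ u v → adj u v ≡ adj v u
    irrefl : ∀ v → adj v v ≡ false
open Graph public

Adj : ∀ {n} → Graph n → Fin n → Fin n → Set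
Adj G u v = T (adj G u v)

InN : ∀ {n} → Graph n → Fin n → Fin n → Set
InN G v w = (w ≡ v) ⊎ Adj G v w

SameClosedNbhd : ∀ {n} → Graph n → Fin n → Fin n → Set
SameClosedNbhd G u v = ∀ w → InN G u w ⇔ InN G v w

anyᶠ : ∀ {n} → (Fin n → Bool) → Bool
anyᶠ {zero}  f = false
anyᶠ {suc n} f = f zero ∨ anyᶠ (λ i → f (suc i))

countᶠ : ∀ {n} → (Fin n → Bool) → ℕ
countᶠ {zero}  f = 0
countᶠ {suc n} f = (if f zero then 1 else 0) + countᶠ (λ i → f (suc i))

∑ : ∀ {k} → (Fin k → ℕ) → ℕ
∑ {zero}  f = 0
∑ {suc k} f = f zero + ∑ (λ j → f (suc j))

numDistinct : List ℕ → ℕ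
numDistinct xs = length (deduplicate ℕ._≟_ xs)

-- The twin cover M = {v_1,…,v_k} is given by m : Fin k → Fin n (injective)

InM : ∀ {n k} → (Fin k → Fin n) → Fin n → Set
InM m v = ∃[ j ] (m j ≡ v)

inMᵇ : ∀ {n k} → (Fin k → Fin n) → Fin n → Bool
inMᵇ m v = anyᶠ (λ j → ⌊ m j Fin.≟ v ⌋)

IsTwinCover : ∀ {n k} → Graph n → (Fin k → Fin n) → Set
IsTwinCover G m = ∀ u v → Adj G u v → InM m u ⊎ InM m v ⊎ SameClosedNbhd G u v

-- Walks in G - M (all vertices after the first outside M, consecutive ones adjacent)
data WalkOutside {n k} (G : Graph n) (m : Fin k → Fin n) : Fin n → Fin n → Set where
  []  : ∀ {v} → WalkOutside G m v v
  _∷_ : ∀ {u v w} → Adj G u v × ¬ InM m v → WalkOutside G m v w → WalkOutside G m u w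

ConnectedOutside : ∀ {n k} → Graph n → (Fin k → Fin n) → Fin n → Fin n → Set
ConnectedOutside G m u v = ¬ InM m u × ¬ InM m v × WalkOutside G m u v

-- comp : V(G) → Fin q labels the components Q_1,…,Q_q of G - M
-- (its values on vertices of M are irrelevant)
IsComponentLabelling : ∀ {n k q} → Graph n → (Fin k → Fin n) → (Fin n → Fin q) → Set
IsComponentLabelling G m comp =
  (∀ i → ∃[ v ] (¬ InM m v × comp v ≡ i)) ×
  (∀ u v → ¬ InM m u → ¬ InM m v → (comp u ≡ comp v ⇔ ConnectedOutside G m u v))

-- w ∈ N_G[Q_i]  (the common closed neighbourhood of the vertices of Q_i)
InNQ : ∀ {n k q} → Graph n → (Fin k → Fin n) → (Fin n → Fin q) → Fin q → Fin n → Set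
InNQ G m comp i w = ∃[ v ] (¬ InM m v × comp v ≡ i × InN G v w)

closedᵇ : ∀ {n} → Graph n → Fin n → Fin n → Bool
closedᵇ G v w = ⌊ w Fin.≟ v ⌋ ∨ adj G v w

matA : ∀ {n k q} → Graph n → (Fin k → Fin n) → (Fin n → Fin q) → Fin q → Fin k → ℕ
matA G m comp i j =
  if anyᶠ (λ v → not (inMᵇ m v) ∧ ⌊ comp v Fin.≟ i ⌋ ∧ closedᵇ G v (m j)) then 1 else 0

vecB : ∀ {n k q} → (Fin k → Fin n) → (Fin n → Fin q) → (Fin n → Bool) → Fin q → ℕ
vecB m comp S i = countᶠ (λ v → not (inMᵇ m v) ∧ ⌊ comp v Fin.≟ i ⌋ ∧ not (S v))

Feasible : ∀ {k q} → (Fin q → Fin k → ℕ) → (Fin q → ℕ) → (Fin k → ℕ) → Set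
Feasible A b x = ∀ i → b i ≤ ∑ (λ j → A i j * x j)

IsOptimalValue : ∀ {k q} → (Fin q → Fin k → ℕ) → (Fin q → ℕ) → ℕ → Set
IsOptimalValue A b opt =
  (∃[ x ] (Feasible A b x × ∑ x ≡ opt)) × (∀ x → Feasible A b x → opt ≤ ∑ x)

-- partial CD coloring χS : S → ℕ (values outside S are irrelevant)
IsPartialCD : ∀ {n} → Graph n → (Fin n → Bool) → (Fin n → ℕ) → Set
IsPartialCD G S χ =
  (∀ u v → T (S u) → T (S v) → Adj G u v → χ u ≢ χ v) ×
  (∀ u → T (S u) → ∃[ w ] (∀ v → T (S v) → χ v ≡ χ u → InN G w v))

IsCD : ∀ {n} → Graph n → (Fin n → ℕ) → Set
IsCD G χ =
  (∀ u v → Adj G u v → χ u ≢ χ v) ×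
  (∀ u → ∃[ w ] (∀ v → χ v ≡ χ u → InN G w v))

numColorsOn : ∀ {n} → (Fin n → Bool) → (Fin n → ℕ) → ℕ
numColorsOn S χ = numDistinct (map χ (filter (λ v → Data.Bool.T? (S v)) (allFin _)))
  where import Data.Bool

numColors : ∀ {n} → (Fin n → ℕ) → ℕ
numColors χ = numDistinct (map χ (allFin _))

IsDisjointExtension : ∀ {n} → Graph n → (Fin n → Bool) → (Fin n → ℕ) → (Fin n → ℕ) → Set
IsDisjointExtension G S χS χ =
  IsCD G χ ×
  (∀ v → T (S v) → χ v ≡ χS v) ×
  (∀ v u → ¬ T (S v) → T (S u) → χ v ≢ χS u)

{-# OPTIONS --safe #-}
module Submission where

-- Every new colour of a disjoint extension χ lives on V ∖ S ⊆ V ∖ M, and its class is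
-- dominated by a vertex v_j of M: by its own dominator if that lies in M; otherwise the
-- dominator lies in the component Q containing the class, and any v_j ∈ N[Q] (one exists
-- as Q is not isolated) dominates the class as well. With x_j the number of new colours so
-- anchored at v_j, the b_i vertices of the clique Q_i ∖ S carry distinct new colours, all
-- anchored in N[Q_i]; hence A x ≥ b and |χ| ≥ ℓ′ + ∑ x ≥ ℓ′ + ℓ*. Conversely an optimal x
-- provides x_j fresh colours per v_j, and the b_i ≤ (A x)_i vertices of Q_i ∖ S receive
-- distinct ones among those reserved for the v_j ∈ N[Q_i], each of which dominates Q_i.

module CDExtension where

  open import Defs hiding (sym)
  open import Level using (Level)
  open import Data.Bool using (Bool; true; false; T; not; _∧_; if_then_else_; T?)
  open import Data.Bool.Properties using (T-∧; T-∨)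
  open import Data.Empty using (⊥-elim)
  open import Data.Fin as Fin using (Fin; zero; suc)
  import Data.Fin.Properties as Fin
  import Data.Integer as ℤ
  import Data.Integer.Properties as ℤ
  open import Data.List using (List; []; _∷_; _++_; length; map; filter; tabulate; allFin; deduplicate; upTo)
  open import Data.List.Properties using (length-++; length-map; length-applyUpTo; length-filter)
  open import Data.List.Membership.Propositional using (_∈_; find; lose)
  open import Data.List.Membership.Propositional.Properties
    using (∈-∃++; ∈-++⁻; ∈-++⁺ˡ; ∈-++⁺ʳ; ∈-map⁺; ∈-map⁻; ∈-filter⁺; ∈-filter⁻; ∈-allFin; ∈-upTo⁺;
           ∈-deduplicate⁺; ∈-deduplicate⁻)
  open import Data.List.Relation.Binary.Subset.Propositional using (_⊆_)
  import Data.List.Relation.Unary.All as All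
  open import Data.List.Relation.Unary.All.Properties using (all-filter)
  open import Data.List.Relation.Unary.AllPairs using (AllPairs; []; _∷_)
  import Data.List.Relation.Unary.AllPairs.Properties as AllPairs
  open import Data.List.Relation.Unary.Any using (here; there)
  import Data.List.Relation.Unary.Any.Properties as Any
  open import Data.List.Relation.Unary.Unique.Propositional using (Unique)
  import Data.List.Relation.Unary.Unique.Propositional.Properties as Unique
  open import Data.List.Relation.Unary.Unique.DecPropositional.Properties using (deduplicate-!)
  open import Data.Nat as ℕ using (ℕ; zero; suc; _+_; _*_; _∸_; _≤_; _<_; z≤n; s≤s)
  open import Data.Nat.ListAction using (sum)
  open import Data.Nat.Properties
  open import Data.Product using (∃-syntax; _×_; _,_; proj₁; proj₂)
  open import Data.Sum using (inj₁; inj₂; map₁)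
  open import Function using (_∘_; id; _⇔_; mk⇔; Equivalence)
  import Function.Properties.Equivalence as ⇔
  open import Relation.Binary using (Rel; Decidable; tri<; tri≈; tri>)
  open import Relation.Binary.PropositionalEquality
  open import Relation.Nullary using (¬_; Dec; yes; no; ¬?; does)
  open import Relation.Nullary.Decidable using (⌊_⌋; toWitness; fromWitness)

  module _ where
    open import Data.Integer using (+_; _-_; _⊖_)

    n≤o-m⇔m+n≤o : ∀ m n o → (+ n ℤ.≤ + o - + m) ⇔ (m + n ≤ o)
    n≤o-m⇔m+n≤o m n o = mk⇔ from to
      where
      to : m + n ≤ o → + n ℤ.≤ + o - + m
      to m+n≤o = begin
        + n            ≡⟨ cong +_ (sym (m+n∸m≡n m n)) ⟩
        + (m + n ∸ m)  ≡⟨ sym (ℤ.⊖-≥ (m≤m+n m n)) ⟩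
        (m + n) ⊖ m    ≤⟨ ℤ.⊖-monoˡ-≤ m m+n≤o ⟩
        o ⊖ m          ≡⟨ sym (ℤ.[+m]-[+n]≡m⊖n o m) ⟩
        + o - + m      ∎
        where open ℤ.≤-Reasoning

      from : + n ℤ.≤ + o - + m → m + n ≤ o
      from n≤o-m = subst (_≤ o) (+-comm n m) (ℤ.drop‿+≤+ (begin
        + n ℤ.+ + m                ≤⟨ ℤ.+-monoˡ-≤ (+ m) n≤o-m ⟩
        (+ o - + m) ℤ.+ + m        ≡⟨ ℤ.+-assoc (+ o) (ℤ.- + m) (+ m) ⟩
        + o ℤ.+ (ℤ.- + m ℤ.+ + m)  ≡⟨ cong (ℤ._+_ (+ o)) (ℤ.+-inverseˡ (+ m)) ⟩
        + o ℤ.+ + 0                ≡⟨ ℤ.+-identityʳ (+ o) ⟩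
        + o                        ∎))
        where open ℤ.≤-Reasoning

  bit : Bool → ℕ
  bit b = if b then 1 else 0

  bit-mono : ∀ {a b} → (T a → T b) → bit a ≤ bit b
  bit-mono {false}         _   = z≤n
  bit-mono {true}  {true}  _   = ≤-refl
  bit-mono {true}  {false} a⇒b = ⊥-elim (a⇒b _)

  bit-* : ∀ b y → bit b * y ≡ (if b then y else 0)
  bit-* true  y = +-identityʳ y
  bit-* false y = refl

  module _ {a b r : Level} {A : Set a} {B : Set b} where

    matching⇒length-≤ : (R : A → B → Set r) {xs : List A} {ys : List B} → Unique xs
      → (∀ {x x′ y} → x ∈ xs → x′ ∈ xs → R x y → R x′ y → x ≡ x′)
      → (∀ {x} → x ∈ xs → ∃[ y ] (y ∈ ys × R x y))
      → length xs ≤ length ys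
    matching⇒length-≤ R {[]}     _            _   _     = z≤n
    matching⇒length-≤ R {x ∷ xs} (x∉xs ∷ xs!) inj cover
      with y , y∈ys , Rxy ← cover (here refl)
      with as , bs , refl ← ∈-∃++ y∈ys = begin
        suc (length xs)              ≤⟨ s≤s (matching⇒length-≤ R xs! (λ p p′ → inj (there p) (there p′)) cover′) ⟩
        suc (length (as ++ bs))      ≡⟨ cong suc (length-++ as) ⟩
        suc (length as + length bs)  ≡⟨ sym (+-suc (length as) (length bs)) ⟩
        length as + length (y ∷ bs)  ≡⟨ sym (length-++ as) ⟩
        length (as ++ y ∷ bs)        ∎
      where
      open ≤-Reasoning
      cover′ : ∀ {x′} → x′ ∈ xs → ∃[ y′ ] (y′ ∈ as ++ bs × R x′ y′)
      cover′ p with y′ , y′∈ys , Rx′y′ ← cover (there p) with ∈-++⁻ as y′∈ys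
      ... | inj₁ q           = y′ , ∈-++⁺ˡ q , Rx′y′
      ... | inj₂ (here refl) = ⊥-elim (All.lookup x∉xs p (inj (here refl) (there p) Rxy Rx′y′))
      ... | inj₂ (there q)   = y′ , ∈-++⁺ʳ as q , Rx′y′

  module _ {a : Level} {A : Set a} where

    Unique-⊆⇒length-≤ : {xs ys : List A} → Unique xs → xs ⊆ ys → length xs ≤ length ys
    Unique-⊆⇒length-≤ xs! xs⊆ys =
      matching⇒length-≤ _≡_ xs! (λ _ _ p q → trans p (sym q)) (λ p → _ , xs⊆ys p , refl)

    AllPairs¬-deduplicate : ∀ {ℓ} {R : Rel A ℓ} (R? : Decidable R) xs
      → AllPairs (λ x y → ¬ R x y) (deduplicate R? xs)
    AllPairs¬-deduplicate R? []       = []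
    AllPairs¬-deduplicate R? (x ∷ xs) =
      all-filter (¬? ∘ R? x) (deduplicate R? xs) ∷ AllPairs.filter⁺ _ (AllPairs¬-deduplicate R? xs)

    length-filter-∷ : ∀ {p} {P : A → Set p} (P? : ∀ x → Dec (P x)) x xs
      → length (filter P? (x ∷ xs)) ≡ bit (does (P? x)) + length (filter P? xs)
    length-filter-∷ P? x xs with does (P? x)
    ... | true  = refl
    ... | false = refl

    length-filter-tabulate : ∀ {n} (p : A → Bool) (g : Fin n → A)
      → length (filter (T? ∘ p) (tabulate g)) ≡ countᶠ (p ∘ g)
    length-filter-tabulate {zero}  p g = refl
    length-filter-tabulate {suc n} p g with p (g zero)
    ... | true  = cong suc (length-filter-tabulate p (g ∘ suc))
    ... | false = length-filter-tabulate p (g ∘ suc)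

    sum-bits : ∀ (p : A → Bool) xs → sum (map (bit ∘ p) xs) ≡ length (filter (T? ∘ p) xs)
    sum-bits p []       = refl
    sum-bits p (x ∷ xs) = trans (cong (bit (p x) +_) (sum-bits p xs)) (sym (length-filter-∷ (T? ∘ p) x xs))

  ∑-cong : ∀ {k} {f g : Fin k → ℕ} → (∀ j → f j ≡ g j) → ∑ f ≡ ∑ g
  ∑-cong {zero}  f≗g = refl
  ∑-cong {suc k} f≗g = cong₂ _+_ (f≗g zero) (∑-cong (f≗g ∘ suc))

  ∑-zero : ∀ k → ∑ {k} (λ _ → 0) ≡ 0
  ∑-zero zero    = refl
  ∑-zero (suc k) = ∑-zero k

  ∑-distrib-+ : ∀ {k} (f g : Fin k → ℕ) → ∑ (λ j → f j + g j) ≡ ∑ f + ∑ g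
  ∑-distrib-+ {zero}  f g = refl
  ∑-distrib-+ {suc k} f g = begin
    (f zero + g zero) + ∑ (λ j → f (suc j) + g (suc j))
      ≡⟨ cong ((f zero + g zero) +_) (∑-distrib-+ (f ∘ suc) (g ∘ suc)) ⟩
    (f zero + g zero) + (∑ (f ∘ suc) + ∑ (g ∘ suc))
      ≡⟨ +-interchange (f zero) (g zero) _ _ ⟩
    (f zero + ∑ (f ∘ suc)) + (g zero + ∑ (g ∘ suc)) ∎
    where
    open ≡-Reasoning
    open import Algebra.Properties.CommutativeSemigroup +-commutativeSemigroup
      using () renaming (interchange to +-interchange)

  term≤∑ : ∀ {k} (f : Fin k → ℕ) j → f j ≤ ∑ f
  term≤∑ f zero    = m≤m+n (f zero) _
  term≤∑ f (suc j) = ≤-trans (term≤∑ (f ∘ suc) j) (m≤n+m _ (f zero))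

  ∑-indicator : ∀ {k} (w : Fin k → ℕ) i → ∑ (λ j → w j * bit (does (i Fin.≟ j))) ≡ w i
  ∑-indicator {suc k} w zero = begin
    w zero * 1 + ∑ (λ j → w (suc j) * 0)
      ≡⟨ cong₂ _+_ (*-identityʳ (w zero)) (∑-cong (λ j → *-zeroʳ (w (suc j)))) ⟩
    w zero + ∑ {k} (λ _ → 0)  ≡⟨ cong (w zero +_) (∑-zero k) ⟩
    w zero + 0                ≡⟨ +-identityʳ (w zero) ⟩
    w zero                    ∎
    where open ≡-Reasoning
  ∑-indicator w (suc i) = begin
    w zero * 0 + ∑ (λ j → w (suc j) * bit (does (suc i Fin.≟ suc j)))
      ≡⟨ cong₂ _+_ (*-zeroʳ (w zero)) (∑-cong suc≟suc) ⟩
    ∑ (λ j → w (suc j) * bit (does (i Fin.≟ j)))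
      ≡⟨ ∑-indicator (w ∘ suc) i ⟩
    w (suc i) ∎
    where
    open ≡-Reasoning
    suc≟suc : ∀ j → w (suc j) * bit (does (suc i Fin.≟ suc j)) ≡ w (suc j) * bit (does (i Fin.≟ j))
    suc≟suc j with i Fin.≟ j
    ... | yes _ = refl
    ... | no _  = refl

  ∑-fibres : ∀ {a} {A : Set a} {k} (f : A → Fin k) (w : Fin k → ℕ) (xs : List A)
    → ∑ (λ j → w j * length (filter (λ x → f x Fin.≟ j) xs)) ≡ sum (map (w ∘ f) xs)
  ∑-fibres {k = k} f w []       = trans (∑-cong (λ j → *-zeroʳ (w j))) (∑-zero k)
  ∑-fibres         f w (x ∷ xs) = begin
    ∑ (λ j → w j * length (filter (λ y → f y Fin.≟ j) (x ∷ xs)))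
      ≡⟨ ∑-cong (λ j → trans (cong (w j *_) (length-filter-∷ (λ y → f y Fin.≟ j) x xs))
                              (*-distribˡ-+ (w j) _ _)) ⟩
    ∑ (λ j → w j * bit (does (f x Fin.≟ j)) + w j * length (filter (λ y → f y Fin.≟ j) xs))
      ≡⟨ ∑-distrib-+ (λ j → w j * bit (does (f x Fin.≟ j))) _ ⟩
    ∑ (λ j → w j * bit (does (f x Fin.≟ j))) + ∑ (λ j → w j * length (filter (λ y → f y Fin.≟ j) xs))
      ≡⟨ cong₂ _+_ (∑-indicator w (f x)) (∑-fibres f w xs) ⟩
    w (f x) + sum (map (w ∘ f) xs) ∎
    where open ≡-Reasoning

  countᶠ-mono : ∀ {n} {f g : Fin n → Bool} → (∀ i → T (f i) → T (g i)) → countᶠ f ≤ countᶠ g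
  countᶠ-mono {zero}  f⇒g = z≤n
  countᶠ-mono {suc n} f⇒g = +-mono-≤ (bit-mono (f⇒g zero)) (countᶠ-mono (f⇒g ∘ suc))

  countᶠ-mono-< : ∀ {n} {f g : Fin n → Bool} → (∀ i → T (f i) → T (g i))
    → ∀ i → T (g i) → ¬ T (f i) → countᶠ f < countᶠ g
  countᶠ-mono-< {suc n} {f} {g} f⇒g zero gi ¬fi with f zero | g zero
  ... | true  | _     = ⊥-elim (¬fi _)
  ... | false | false = ⊥-elim gi
  ... | false | true  = s≤s (countᶠ-mono (f⇒g ∘ suc))
  countᶠ-mono-< {suc n} f⇒g (suc i) gi ¬fi =
    +-mono-≤-< (bit-mono (f⇒g zero)) (countᶠ-mono-< (f⇒g ∘ suc) i gi ¬fi)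

  rank : ∀ {n} → (Fin n → Bool) → Fin n → ℕ
  rank p v = countᶠ (λ u → p u ∧ ⌊ u Fin.<? v ⌋)

  module _ {n} (p : Fin n → Bool) where

    private
      T-below : ∀ (u v : Fin n) → T (p u ∧ ⌊ u Fin.<? v ⌋) → T (p u) × u Fin.< v
      T-below u v h with pu , u<v ← Equivalence.to (T-∧ {p u}) h = pu , toWitness u<v

      below-T : ∀ (u v : Fin n) → T (p u) → u Fin.< v → T (p u ∧ ⌊ u Fin.<? v ⌋)
      below-T u v pu u<v = Equivalence.from (T-∧ {p u}) (pu , fromWitness u<v)

    rank-< : ∀ {v} → T (p v) → rank p v < countᶠ p
    rank-< {v} pv = countᶠ-mono-< (λ u → proj₁ ∘ T-below u v) v pv (<-irrefl refl ∘ proj₂ ∘ T-below v v)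

    rank-mono-< : ∀ {u v} → T (p u) → u Fin.< v → rank p u < rank p v
    rank-mono-< {u} {v} pu u<v =
      countᶠ-mono-< below-u⇒below-v u (below-T u v pu u<v) (<-irrefl refl ∘ proj₂ ∘ T-below u u)
      where
      below-u⇒below-v : ∀ w → T (p w ∧ ⌊ w Fin.<? u ⌋) → T (p w ∧ ⌊ w Fin.<? v ⌋)
      below-u⇒below-v w h = let pw , w<u = T-below w u h in below-T w v pw (<-trans w<u u<v)

    rank-injective : ∀ {u v} → T (p u) → T (p v) → rank p u ≡ rank p v → u ≡ v
    rank-injective {u} {v} pu pv eq with Fin.<-cmp u v
    ... | tri< u<v _ _ = ⊥-elim (<-irrefl eq (rank-mono-< pu u<v))
    ... | tri≈ _ u≡v _ = u≡v
    ... | tri> _ _ v<u = ⊥-elim (<-irrefl (sym eq) (rank-mono-< pv v<u))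

  -- Slots: [0, ∑ x) is cut into consecutive blocks, the j-th of length x j, and
  -- slot β x r is the r-th element of the union of the blocks j with β j.

  select : ∀ {k} → (Fin k → Bool) → (Fin k → ℕ) → Fin k → ℕ
  select β x j = if β j then x j else 0

  InBlock : ∀ {k} → (Fin k → ℕ) → Fin k → ℕ → Set
  InBlock x zero    c = c < x zero
  InBlock x (suc j) c = x zero ≤ c × InBlock (x ∘ suc) j (c ∸ x zero)

  InBlock-functional : ∀ {k} (x : Fin k → ℕ) {j j′ c} → InBlock x j c → InBlock x j′ c → j ≡ j′
  InBlock-functional x {zero}  {zero}  _          _          = refl
  InBlock-functional x {zero}  {suc _} c<x₀       (x₀≤c , _) = ⊥-elim (<⇒≱ c<x₀ x₀≤c)
  InBlock-functional x {suc _} {zero}  (x₀≤c , _) c<x₀       = ⊥-elim (<⇒≱ c<x₀ x₀≤c)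
  InBlock-functional x {suc _} {suc _} (_ , c∈j)  (_ , c∈j′) = cong suc (InBlock-functional (x ∘ suc) c∈j c∈j′)

  InBlock-suc : ∀ {k} (x : Fin (suc k) → ℕ) {j c} → InBlock (x ∘ suc) j c → InBlock x (suc j) (x zero + c)
  InBlock-suc x {j} c∈j = m≤m+n (x zero) _ , subst (InBlock (x ∘ suc) j) (sym (m+n∸m≡n (x zero) _)) c∈j

  InBlock⇒<∑ : ∀ {k} (x : Fin k → ℕ) {j c} → InBlock x j c → c < ∑ x
  InBlock⇒<∑ x {zero}      c<x₀         = <-≤-trans c<x₀ (m≤m+n (x zero) _)
  InBlock⇒<∑ x {suc j} {c} (x₀≤c , c∈j) = begin-strict
    c                      ≡⟨ sym (m+[n∸m]≡n x₀≤c) ⟩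
    x zero + (c ∸ x zero)  <⟨ +-monoʳ-< (x zero) (InBlock⇒<∑ (x ∘ suc) c∈j) ⟩
    x zero + ∑ (x ∘ suc)   ∎
    where open ≤-Reasoning

  slot : ∀ {k} → (Fin k → Bool) → (Fin k → ℕ) → ℕ → ℕ
  slot {zero}  β x r = r
  slot {suc k} β x r with β zero | r <? x zero
  ... | true  | yes _ = r
  ... | true  | no _  = x zero + slot (β ∘ suc) (x ∘ suc) (r ∸ x zero)
  ... | false | _     = x zero + slot (β ∘ suc) (x ∘ suc) r

  private
    m≤n⇒n<m+o⇒n∸m<o : ∀ {m n o} → m ≤ n → n < m + o → n ∸ m < o
    m≤n⇒n<m+o⇒n∸m<o {m} {n} {o} m≤n n<m+o = subst (n ∸ m <_) (m+n∸m≡n m o) (∸-monoˡ-< n<m+o m≤n)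

  slot-InBlock : ∀ {k} (β : Fin k → Bool) (x : Fin k → ℕ) {r} → r < ∑ (select β x)
    → ∃[ j ] (T (β j) × InBlock x j (slot β x r))
  slot-InBlock {suc k} β x {r} r<cap with β zero in β₀ | r <? x zero
  ... | true  | yes r<x₀ = zero , subst T (sym β₀) _ , r<x₀
  ... | true  | no r≮x₀
    with j , βj , r∈j ← slot-InBlock (β ∘ suc) (x ∘ suc) (m≤n⇒n<m+o⇒n∸m<o (≮⇒≥ r≮x₀) r<cap) =
    suc j , βj , InBlock-suc x r∈j
  ... | false | _
    with j , βj , r∈j ← slot-InBlock (β ∘ suc) (x ∘ suc) r<cap =
    suc j , βj , InBlock-suc x r∈j

  slot-injective : ∀ {k} (β : Fin k → Bool) (x : Fin k → ℕ) {r r′}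
    → r < ∑ (select β x) → r′ < ∑ (select β x) → slot β x r ≡ slot β x r′ → r ≡ r′
  slot-injective {suc k} β x {r} {r′} r<cap r′<cap eq with β zero | r <? x zero | r′ <? x zero
  ... | true  | yes _    | yes _     = eq
  ... | true  | yes r<x₀ | no _      = ⊥-elim (<⇒≱ r<x₀ (subst (x zero ≤_) (sym eq) (m≤m+n _ _)))
  ... | true  | no _     | yes r′<x₀ = ⊥-elim (<⇒≱ r′<x₀ (subst (x zero ≤_) eq (m≤m+n _ _)))
  ... | true  | no r≮x₀  | no r′≮x₀  = begin
    r                       ≡⟨ sym (m+[n∸m]≡n (≮⇒≥ r≮x₀)) ⟩
    x zero + (r ∸ x zero)   ≡⟨ cong (x zero +_) (slot-injective (β ∘ suc) (x ∘ suc)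
                                 (m≤n⇒n<m+o⇒n∸m<o (≮⇒≥ r≮x₀) r<cap) (m≤n⇒n<m+o⇒n∸m<o (≮⇒≥ r′≮x₀) r′<cap)
                                 (+-cancelˡ-≡ (x zero) _ _ eq)) ⟩
    x zero + (r′ ∸ x zero)  ≡⟨ m+[n∸m]≡n (≮⇒≥ r′≮x₀) ⟩
    r′                      ∎
    where open ≡-Reasoning
  ... | false | _ | _ = slot-injective (β ∘ suc) (x ∘ suc) r<cap r′<cap (+-cancelˡ-≡ (x zero) _ _ eq)

  T-anyᶠ : ∀ {n} (f : Fin n → Bool) → T (anyᶠ f) ⇔ (∃[ i ] T (f i))
  T-anyᶠ {zero}  f = mk⇔ (λ ()) (λ ())
  T-anyᶠ {suc n} f = mk⇔ to from
    where
    to : T (anyᶠ f) → ∃[ i ] T (f i)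
    to h with Equivalence.to (T-∨ {f zero}) h
    ... | inj₁ f₀ = zero , f₀
    ... | inj₂ fₛ with i , fi ← Equivalence.to (T-anyᶠ (f ∘ suc)) fₛ = suc i , fi
    from : ∃[ i ] T (f i) → T (anyᶠ f)
    from (zero  , f₀) = Equivalence.from (T-∨ {f zero}) (inj₁ f₀)
    from (suc i , fi) = Equivalence.from (T-∨ {f zero}) (inj₂ (Equivalence.from (T-anyᶠ (f ∘ suc)) (i , fi)))

  T-not : ∀ {b} → T (not b) ⇔ (¬ T b)
  T-not {true}  = mk⇔ (λ ()) (λ ¬t → ¬t _)
  T-not {false} = mk⇔ (λ _ ()) _

  T-∧³ : ∀ {a b c} → T (a ∧ b ∧ c) ⇔ (T a × T b × T c)
  T-∧³ {true}  {true}  {true}  = mk⇔ _ _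
  T-∧³ {true}  {true}  {false} = mk⇔ (λ ()) (λ ())
  T-∧³ {true}  {false}         = mk⇔ (λ ()) (λ ())
  T-∧³ {false}                 = mk⇔ (λ ()) (λ ())

  T-notInMᵇ : ∀ {n k} (m : Fin k → Fin n) {v} → T (not (inMᵇ m v)) ⇔ (¬ InM m v)
  T-notInMᵇ m {v} = mk⇔ (λ h → Equivalence.to T-not h ∘ from) (Equivalence.from T-not ∘ λ ¬M → ¬M ∘ to)
    where
    to : T (inMᵇ m v) → InM m v
    to h with j , mj≟v ← Equivalence.to (T-anyᶠ _) h = j , toWitness mj≟v
    from : InM m v → T (inMᵇ m v)
    from (j , mj≡v) = Equivalence.from (T-anyᶠ _) (j , fromWitness mj≡v)

  T-closedᵇ : ∀ {n} (G : Graph n) {v w} → T (closedᵇ G v w) ⇔ InN G v w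
  T-closedᵇ G {v} {w} = mk⇔
    (map₁ toWitness ∘ Equivalence.to (T-∨ {⌊ w Fin.≟ v ⌋}))
    (Equivalence.from (T-∨ {⌊ w Fin.≟ v ⌋}) ∘ map₁ fromWitness)

  module _ {n k q} (G : Graph n) (m : Fin k → Fin n) (comp : Fin n → Fin q) where

    inNQᵇ : Fin q → Fin n → Bool
    inNQᵇ i w = anyᶠ (λ v → not (inMᵇ m v) ∧ ⌊ comp v Fin.≟ i ⌋ ∧ closedᵇ G v w)

    T-inNQᵇ : ∀ {i w} → T (inNQᵇ i w) ⇔ InNQ G m comp i w
    T-inNQᵇ {i} {w} = mk⇔ to from
      where
      to : T (inNQᵇ i w) → InNQ G m comp i w
      to h with v , hv ← Equivalence.to (T-anyᶠ _) h
           with v∉M , v∈Qᵢ , w∈N[v] ← Equivalence.to (T-∧³ {not (inMᵇ m v)}) hv =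
        v , Equivalence.to (T-notInMᵇ m) v∉M , toWitness v∈Qᵢ , Equivalence.to (T-closedᵇ G) w∈N[v]
      from : InNQ G m comp i w → T (inNQᵇ i w)
      from (v , v∉M , v∈Qᵢ , w∈N[v]) = Equivalence.from (T-anyᶠ _) (v , Equivalence.from (T-∧³ {not (inMᵇ m v)})
        (Equivalence.from (T-notInMᵇ m) v∉M , fromWitness v∈Qᵢ , Equivalence.from (T-closedᵇ G) w∈N[v]))

  module _ {n} (G : Graph n) where

    Adj-sym : ∀ {u v} → Adj G u v → Adj G v u
    Adj-sym {u} {v} = subst T (Graph.sym G u v)

    Adj-irrefl : ∀ {v} → ¬ Adj G v v
    Adj-irrefl {v} = subst T (Graph.irrefl G v)

    InN-sym : ∀ {u v} → InN G u v → InN G v u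
    InN-sym (inj₁ v≡u) = inj₁ (sym v≡u)
    InN-sym (inj₂ u~v) = inj₂ (Adj-sym u~v)

  module _ {n k q} {G : Graph n} {m : Fin k → Fin n} {comp : Fin n → Fin q}
           (tc : IsTwinCover G m) (lab : IsComponentLabelling G m comp) where

    walk⇒twins : ∀ {u v} → ¬ InM m u → WalkOutside G m u v → SameClosedNbhd G u v
    walk⇒twins _ [] _ = ⇔.refl
    walk⇒twins {u} u∉M ((u~v , v∉M) ∷ walk) w with tc u _ u~v
    ... | inj₁ u∈M          = ⊥-elim (u∉M u∈M)
    ... | inj₂ (inj₁ v∈M)   = ⊥-elim (v∉M v∈M)
    ... | inj₂ (inj₂ twins) = ⇔.trans (twins w) (walk⇒twins v∉M walk w)

    sameComponent⇒twins : ∀ {u v} → ¬ InM m u → ¬ InM m v → comp u ≡ comp v → SameClosedNbhd G u v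
    sameComponent⇒twins {u} {v} u∉M v∉M eq
      with _ , _ , walk ← Equivalence.to (proj₂ lab u v u∉M v∉M) eq = walk⇒twins u∉M walk

    component-clique : ∀ {u v} → ¬ InM m u → ¬ InM m v → comp u ≡ comp v → u ≢ v → Adj G u v
    component-clique u∉M v∉M eq u≢v
      with Equivalence.from (sameComponent⇒twins u∉M v∉M eq _) (inj₁ refl)
    ... | inj₁ v≡u = ⊥-elim (u≢v (sym v≡u))
    ... | inj₂ u~v = u~v

    InN⇒sameComponent : ∀ {u v} → InN G u v → ¬ InM m u → ¬ InM m v → comp u ≡ comp v
    InN⇒sameComponent (inj₁ v≡u) _ _ = cong comp (sym v≡u)
    InN⇒sameComponent {u} {v} (inj₂ u~v) u∉M v∉M =
      Equivalence.from (proj₂ lab u v u∉M v∉M) (u∉M , v∉M , (u~v , v∉M) ∷ [])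

    InNQ-dominates : ∀ {i w v} → InNQ G m comp i w → ¬ InM m v → comp v ≡ i → InN G w v
    InNQ-dominates (v′ , v′∉M , v′∈Qᵢ , w∈N[v′]) v∉M v∈Qᵢ = InN-sym G
      (Equivalence.to (sameComponent⇒twins v′∉M v∉M (trans v′∈Qᵢ (sym v∈Qᵢ)) _) w∈N[v′])

  module _ {n k q} {G : Graph n} {m : Fin k → Fin n} {comp : Fin n → Fin q}
           (tc : IsTwinCover G m) (lab : IsComponentLabelling G m comp)
           {S : Fin n → Bool} {χS : Fin n → ℕ} (pcd : IsPartialCD G S χS)
           (M⊆S : ∀ j → T (S (m j))) where

    uncolouredᵇ : Fin q → Fin n → Bool
    uncolouredᵇ i v = not (inMᵇ m v) ∧ ⌊ comp v Fin.≟ i ⌋ ∧ not (S v)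

    attachedᵇ : Fin q → Fin k → Bool
    attachedᵇ i j = inNQᵇ G m comp i (m j)

    -- length oldColours is numColorsOn S χS, definitionally.
    oldColours : List ℕ
    oldColours = deduplicate ℕ._≟_ (map χS (filter (λ v → T? (S v)) (allFin n)))

    ∉S⇒∉M : ∀ {v} → ¬ T (S v) → ¬ InM m v
    ∉S⇒∉M v∉S (j , refl) = v∉S (M⊆S j)

    T-uncolouredᵇ : ∀ {i v} → T (uncolouredᵇ i v) ⇔ (comp v ≡ i × ¬ T (S v))
    T-uncolouredᵇ {i} {v} = mk⇔ to from
      where
      to : T (uncolouredᵇ i v) → comp v ≡ i × ¬ T (S v)
      to h with _ , v∈Qᵢ , v∉S ← Equivalence.to (T-∧³ {not (inMᵇ m v)}) h =
        toWitness v∈Qᵢ , Equivalence.to T-not v∉S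
      from : comp v ≡ i × ¬ T (S v) → T (uncolouredᵇ i v)
      from (v∈Qᵢ , v∉S) = Equivalence.from (T-∧³ {not (inMᵇ m v)})
        (Equivalence.from (T-notInMᵇ m) (∉S⇒∉M v∉S) , fromWitness v∈Qᵢ , Equivalence.from T-not v∉S)

    oldColour∈ : ∀ {v} → T (S v) → χS v ∈ oldColours
    oldColour∈ v∈S = ∈-deduplicate⁺ ℕ._≟_ (∈-map⁺ χS (∈-filter⁺ (λ v → T? (S v)) (∈-allFin _) v∈S))

    oldColour∈⁻ : ∀ {c} → c ∈ oldColours → ∃[ u ] (T (S u) × c ≡ χS u)
    oldColour∈⁻ p with u , u∈ , refl ← ∈-map⁻ χS (∈-deduplicate⁻ ℕ._≟_ _ p) =
      u , proj₂ (∈-filter⁻ (λ v → T? (S v)) {xs = allFin n} u∈) , refl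

    -- New colours start at K, above every old colour; the colours of block j go only to
    -- components Q with v_j ∈ N[Q], so v_j dominates each such colour class.
    module Backward (x : Fin k → ℕ) (feasible : Feasible (matA G m comp) (vecB m comp S) x) where

      K : ℕ
      K = suc (∑ χS)

      newColour : Fin q → Fin n → ℕ
      newColour i v = slot (attachedᵇ i) x (rank (uncolouredᵇ i) v)

      χ : Fin n → ℕ
      χ v = if S v then χS v else K + newColour (comp v) v

      capacity : ∀ i → countᶠ (uncolouredᵇ i) ≤ ∑ (select (attachedᵇ i) x)
      capacity i = ≤-trans (feasible i) (≤-reflexive (∑-cong (λ j → bit-* (attachedᵇ i j) (x j))))

      rank<capacity : ∀ {i v} → T (uncolouredᵇ i v) → rank (uncolouredᵇ i) v < ∑ (select (attachedᵇ i) x)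
      rank<capacity {i} {v} v∈Qᵢ∖S = <-≤-trans (rank-< (uncolouredᵇ i) {v} v∈Qᵢ∖S) (capacity i)

      newColour-injective : ∀ {i u v} → T (uncolouredᵇ i u) → T (uncolouredᵇ i v)
        → newColour i u ≡ newColour i v → u ≡ v
      newColour-injective {i} {u} {v} u∈Qᵢ∖S v∈Qᵢ∖S eq = rank-injective (uncolouredᵇ i) u∈Qᵢ∖S v∈Qᵢ∖S
        (slot-injective (attachedᵇ i) x (rank<capacity {i} {u} u∈Qᵢ∖S) (rank<capacity {i} {v} v∈Qᵢ∖S) eq)

      newColour-InBlock : ∀ {v} → ¬ T (S v)
        → ∃[ j ] (T (attachedᵇ (comp v) j) × InBlock x j (newColour (comp v) v))
      newColour-InBlock {v} v∉S =
        slot-InBlock (attachedᵇ _) x (rank<capacity {comp v} {v} (Equivalence.from T-uncolouredᵇ (refl , v∉S)))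

      χ-old : ∀ {v} → T (S v) → χ v ≡ χS v
      χ-old {v} v∈S with S v
      ... | true = refl

      χ-new : ∀ {v} → ¬ T (S v) → χ v ≡ K + newColour (comp v) v
      χ-new {v} v∉S with S v
      ... | true  = ⊥-elim (v∉S _)
      ... | false = refl

      old≢new : ∀ {u v} → T (S u) → ¬ T (S v) → χ u ≢ χ v
      old≢new {u} {v} u∈S v∉S eq = <⇒≱ (s≤s (term≤∑ χS u)) (begin
        K                         ≤⟨ m≤m+n K _ ⟩
        K + newColour (comp v) v  ≡⟨ sym (χ-new v∉S) ⟩
        χ v                       ≡⟨ sym eq ⟩
        χ u                       ≡⟨ χ-old u∈S ⟩
        χS u                      ∎)
        where open ≤-Reasoning

      new≡new : ∀ {u v} → ¬ T (S u) → ¬ T (S v) → χ u ≡ χ v → newColour (comp u) u ≡ newColour (comp v) v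
      new≡new u∉S v∉S eq = +-cancelˡ-≡ K _ _ (trans (sym (χ-new u∉S)) (trans eq (χ-new v∉S)))

      proper : ∀ u v → Adj G u v → χ u ≢ χ v
      proper u v u~v with T? (S u) | T? (S v)
      ... | yes u∈S | yes v∈S = λ eq →
        proj₁ pcd u v u∈S v∈S u~v (trans (sym (χ-old u∈S)) (trans eq (χ-old v∈S)))
      ... | yes u∈S | no v∉S  = old≢new u∈S v∉S
      ... | no u∉S  | yes v∈S = old≢new v∈S u∉S ∘ sym
      ... | no u∉S  | no v∉S  = λ eq → Adj-irrefl G (subst (Adj G u) (sym (u≡v eq)) u~v)
        where
        sameQ : comp u ≡ comp v
        sameQ = InN⇒sameComponent tc lab (inj₂ u~v) (∉S⇒∉M u∉S) (∉S⇒∉M v∉S)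
        u≡v : χ u ≡ χ v → u ≡ v
        u≡v eq = newColour-injective {comp v} {u} {v}
          (Equivalence.from T-uncolouredᵇ (sameQ , u∉S)) (Equivalence.from T-uncolouredᵇ (refl , v∉S))
          (trans (cong (λ i → newColour i u) (sym sameQ)) (new≡new u∉S v∉S eq))

      dominated : ∀ u → ∃[ w ] (∀ v → χ v ≡ χ u → InN G w v)
      dominated u with T? (S u)
      ... | yes u∈S with w , dom ← proj₂ pcd u u∈S = w , dom′
        where
        dom′ : ∀ v → χ v ≡ χ u → InN G w v
        dom′ v eq with T? (S v)
        ... | yes v∈S = dom v v∈S (trans (sym (χ-old v∈S)) (trans eq (χ-old u∈S)))
        ... | no v∉S  = ⊥-elim (old≢new u∈S v∉S (sym eq))
      dominated u | no u∉S with j , _ , u∈j ← newColour-InBlock u∉S = m j , dom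
        where
        dom : ∀ v → χ v ≡ χ u → InN G (m j) v
        dom v eq with T? (S v)
        ... | yes v∈S = ⊥-elim (old≢new v∈S u∉S eq)
        ... | no v∉S with j′ , attached′ , v∈j′ ← newColour-InBlock v∉S =
          InNQ-dominates tc lab (Equivalence.to (T-inNQᵇ G m comp) (subst (T ∘ attachedᵇ (comp v)) j′≡j attached′))
            (∉S⇒∉M v∉S) refl
          where
          j′≡j : j′ ≡ j
          j′≡j = InBlock-functional x v∈j′ (subst (InBlock x j) (sym (new≡new v∉S u∉S eq)) u∈j)

      isDisjointExtension : IsDisjointExtension G S χS χ
      isDisjointExtension = (proper , dominated) , (λ _ → χ-old) ,
        λ v u v∉S u∈S eq → old≢new u∈S v∉S (trans (χ-old u∈S) (sym eq))

      numColors≤ : numColors χ ≤ length oldColours + ∑ x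
      numColors≤ = begin
        numColors χ                                           ≤⟨ Unique-⊆⇒length-≤ (deduplicate-! ℕ._≟_ _) colour∈ ⟩
        length (oldColours ++ map (K +_) (upTo (∑ x)))        ≡⟨ length-++ oldColours ⟩
        length oldColours + length (map (K +_) (upTo (∑ x)))  ≡⟨ cong (length oldColours +_) length-new ⟩
        length oldColours + ∑ x                               ∎
        where
        open ≤-Reasoning
        length-new : length (map (K +_) (upTo (∑ x))) ≡ ∑ x
        length-new = trans (length-map (K +_) (upTo (∑ x))) (length-applyUpTo id (∑ x))
        colour∈ : ∀ {c} → c ∈ deduplicate ℕ._≟_ (map χ (allFin n)) → c ∈ oldColours ++ map (K +_) (upTo (∑ x))
        colour∈ p with v , _ , refl ← ∈-map⁻ χ (∈-deduplicate⁻ ℕ._≟_ _ p) with T? (S v)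
        ... | yes v∈S = ∈-++⁺ˡ (subst (_∈ oldColours) (sym (χ-old v∈S)) (oldColour∈ v∈S))
        ... | no v∉S with _ , _ , v∈j ← newColour-InBlock v∉S =
          ∈-++⁺ʳ oldColours (subst (_∈ map (K +_) (upTo (∑ x))) (sym (χ-new v∉S))
            (∈-map⁺ (K +_) (∈-upTo⁺ (InBlock⇒<∑ x v∈j))))

    module Forward (noIsolated : ∀ i → ∃[ j ] InNQ G m comp i (m j))
                   (χ : Fin n → ℕ) (ext : IsDisjointExtension G S χS χ) where

      private
        isCD : IsCD G χ
        isCD = proj₁ ext

        agrees : ∀ v → T (S v) → χ v ≡ χS v
        agrees = proj₁ (proj₂ ext)

        avoids : ∀ v u → ¬ T (S v) → T (S u) → χ v ≢ χS u
        avoids = proj₂ (proj₂ ext)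

      dominator : Fin n → Fin n
      dominator v = proj₁ (proj₂ isCD v)

      anchor : Fin n → Fin k
      anchor v with Fin.any? (λ j → m j Fin.≟ dominator v)
      ... | yes (j , _) = j
      ... | no _        = proj₁ (noIsolated (comp (dominator v)))

      anchor-attached : ∀ {v y} → ¬ T (S y) → χ y ≡ χ v → InNQ G m comp (comp y) (m (anchor v))
      anchor-attached {v} {y} y∉S eq with Fin.any? (λ j → m j Fin.≟ dominator v)
      ... | yes (j , mj≡w) = y , ∉S⇒∉M y∉S , refl , InN-sym G (subst (λ w → InN G w y) (sym mj≡w) y∈N[w])
        where
        y∈N[w] : InN G (dominator v) y
        y∈N[w] = proj₂ (proj₂ isCD v) y eq
      ... | no w∉M = subst (λ i → InNQ G m comp i (m j₀)) sameQ attached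
        where
        j₀ : Fin k
        j₀ = proj₁ (noIsolated (comp (dominator v)))
        attached : InNQ G m comp (comp (dominator v)) (m j₀)
        attached = proj₂ (noIsolated (comp (dominator v)))
        sameQ : comp (dominator v) ≡ comp y
        sameQ = InN⇒sameComponent tc lab (proj₂ (proj₂ isCD v) y eq) w∉M (∉S⇒∉M y∉S)

      newVertices : List (Fin n)
      newVertices = filter (λ v → ¬? (T? (S v))) (allFin n)

      representatives : List (Fin n)
      representatives = deduplicate (λ u v → χ u ℕ.≟ χ v) newVertices

      representatives-distinct : AllPairs (λ u v → χ u ≢ χ v) representatives
      representatives-distinct = AllPairs¬-deduplicate _ newVertices

      representative-new : ∀ {r} → r ∈ representatives → ¬ T (S r)
      representative-new p =
        proj₂ (∈-filter⁻ (λ v → ¬? (T? (S v))) {xs = allFin n} (∈-deduplicate⁻ _ newVertices p))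

      representative : ∀ {v} → ¬ T (S v) → ∃[ r ] (r ∈ representatives × χ r ≡ χ v)
      representative {v} v∉S = find (Any.deduplicate⁺ _ trans
        (lose {P = λ r → χ r ≡ χ v} (∈-filter⁺ (λ v → ¬? (T? (S v))) (∈-allFin v) v∉S) refl))

      x : Fin k → ℕ
      x j = length (filter (λ r → anchor r Fin.≟ j) representatives)

      feasible : Feasible (matA G m comp) (vecB m comp S) x
      feasible i = begin
        vecB m comp S i
          ≡⟨ sym (length-filter-tabulate (uncolouredᵇ i) id) ⟩
        length Qᵢ∖S
          ≤⟨ matching⇒length-≤ (λ v r → χ r ≡ χ v) (Unique.filter⁺ _ (Unique.allFin⁺ n)) injective cover ⟩
        length (filter (T? ∘ attachedᵇ i ∘ anchor) representatives)
          ≡⟨ sym (sum-bits (attachedᵇ i ∘ anchor) representatives) ⟩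
        sum (map (bit ∘ attachedᵇ i ∘ anchor) representatives)
          ≡⟨ sym (∑-fibres anchor (matA G m comp i) representatives) ⟩
        ∑ (λ j → matA G m comp i j * x j) ∎
        where
        open ≤-Reasoning
        Qᵢ∖S : List (Fin n)
        Qᵢ∖S = filter (T? ∘ uncolouredᵇ i) (allFin n)
        uncoloured : ∀ {v} → v ∈ Qᵢ∖S → comp v ≡ i × ¬ T (S v)
        uncoloured p = Equivalence.to T-uncolouredᵇ (proj₂ (∈-filter⁻ (T? ∘ uncolouredᵇ i) {xs = allFin n} p))
        injective : ∀ {v v′ r} → v ∈ Qᵢ∖S → v′ ∈ Qᵢ∖S → χ r ≡ χ v → χ r ≡ χ v′ → v ≡ v′
        injective {v} {v′} p p′ eq eq′ with v Fin.≟ v′ | uncoloured p | uncoloured p′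
        ... | yes v≡v′ | _ | _ = v≡v′
        ... | no v≢v′ | v∈Qᵢ , v∉S | v′∈Qᵢ , v′∉S = ⊥-elim (proj₁ isCD v v′ v~v′ (trans (sym eq) eq′))
          where
          v~v′ : Adj G v v′
          v~v′ = component-clique tc lab (∉S⇒∉M v∉S) (∉S⇒∉M v′∉S) (trans v∈Qᵢ (sym v′∈Qᵢ)) v≢v′
        cover : ∀ {v} → v ∈ Qᵢ∖S → ∃[ r ] (r ∈ filter (T? ∘ attachedᵇ i ∘ anchor) representatives × χ r ≡ χ v)
        cover p with refl , v∉S ← uncoloured p with r , r∈ , χr≡χv ← representative v∉S =
          r , ∈-filter⁺ (T? ∘ attachedᵇ i ∘ anchor) r∈
                (Equivalence.from (T-inNQᵇ G m comp) (anchor-attached v∉S (sym χr≡χv))) , χr≡χv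

      ∑x≤representatives : ∑ x ≤ length representatives
      ∑x≤representatives = begin
        ∑ x                                              ≡⟨ ∑-cong (λ j → sym (*-identityˡ (x j))) ⟩
        ∑ (λ j → 1 * x j)                                ≡⟨ ∑-fibres anchor (λ _ → 1) representatives ⟩
        sum (map (λ _ → 1) representatives)              ≡⟨ sum-bits (λ _ → true) representatives ⟩
        length (filter (λ _ → T? true) representatives)  ≤⟨ length-filter (λ _ → T? true) representatives ⟩
        length representatives                           ∎
        where open ≤-Reasoning

      representatives≤numColors : length oldColours + length representatives ≤ numColors χ
      representatives≤numColors = begin
        length oldColours + length representatives          ≡⟨ cong (length oldColours +_)
                                                                 (sym (length-map χ representatives)) ⟩
        length oldColours + length (map χ representatives)  ≡⟨ sym (length-++ oldColours) ⟩
        length (oldColours ++ map χ representatives)        ≤⟨ Unique-⊆⇒length-≤ distinct colour∈ ⟩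
        numColors χ                                         ∎
        where
        open ≤-Reasoning
        disjoint : ∀ {c} → ¬ (c ∈ oldColours × c ∈ map χ representatives)
        disjoint (old , new) with u , u∈S , refl ← oldColour∈⁻ old with r , r∈ , eq ← ∈-map⁻ χ new =
          avoids r u (representative-new r∈) u∈S (sym eq)
        distinct : Unique (oldColours ++ map χ representatives)
        distinct = Unique.++⁺ (deduplicate-! ℕ._≟_ _) (AllPairs.map⁺ representatives-distinct) disjoint
        colour∈ : ∀ {c} → c ∈ oldColours ++ map χ representatives → c ∈ deduplicate ℕ._≟_ (map χ (allFin n))
        colour∈ p with ∈-++⁻ oldColours p
        ... | inj₁ old with u , u∈S , refl ← oldColour∈⁻ old =
          ∈-deduplicate⁺ ℕ._≟_ (subst (_∈ map χ (allFin n)) (agrees u u∈S) (∈-map⁺ χ (∈-allFin u)))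
        ... | inj₂ new with r , _ , refl ← ∈-map⁻ χ new = ∈-deduplicate⁺ ℕ._≟_ (∈-map⁺ χ (∈-allFin r))

    disjointExtension⇔ : (∀ i → ∃[ j ] InNQ G m comp i (m j))
      → ∀ {ℓ*} → IsOptimalValue (matA G m comp) (vecB m comp S) ℓ* → ∀ ℓ
      → (∃[ χ ] (IsDisjointExtension G S χS χ × numColors χ ≤ ℓ)) ⇔ (numColorsOn S χS + ℓ* ≤ ℓ)
    disjointExtension⇔ noIsolated {ℓ*} ((x* , x*-feasible , ∑x*≡ℓ*) , optimal) ℓ = mk⇔ to from
      where
      to : ∃[ χ ] (IsDisjointExtension G S χS χ × numColors χ ≤ ℓ) → numColorsOn S χS + ℓ* ≤ ℓ
      to (χ , ext , χ≤ℓ) = begin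
        length oldColours + ℓ*                       ≤⟨ +-monoʳ-≤ (length oldColours)
                                                          (≤-trans (optimal x feasible) ∑x≤representatives) ⟩
        length oldColours + length representatives  ≤⟨ representatives≤numColors ⟩
        numColors χ                                  ≤⟨ χ≤ℓ ⟩
        ℓ                                            ∎
        where
        open ≤-Reasoning
        open Forward noIsolated χ ext
      from : numColorsOn S χS + ℓ* ≤ ℓ → ∃[ χ ] (IsDisjointExtension G S χS χ × numColors χ ≤ ℓ)
      from bound = χ , isDisjointExtension ,
        ≤-trans numColors≤ (subst (λ t → length oldColours + t ≤ ℓ) (sym ∑x*≡ℓ*) bound)
        where open Backward x* x*-feasible


open import Defs
open import Data.Nat using (ℕ)
open import Data.Integer using (+_; _-_; _≤_)
open import Data.Bool using (Bool; T)
open import Data.Fin using (Fin)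
open import Data.Product using (∃-syntax; _×_)
open import Relation.Nullary using (¬_)
open import Function.Definitions using (Injective)
open import Relation.Binary.PropositionalEquality using (_≡_)
open import Function.Bundles using (_⇔_)
import Data.Nat
import Function.Properties.Equivalence as ⇔
open CDExtension using (disjointExtension⇔; n≤o-m⇔m+n≤o)

lemma1 : ∀ {n k q} (G : Graph n) (m : Fin k → Fin n) (comp : Fin n → Fin q)
         → Injective _≡_ _≡_ m
         → IsTwinCover G m
         → IsComponentLabelling G m comp
         → (∀ i → ∃[ j ] InNQ G m comp i (m j))
         → (S : Fin n → Bool) (χS : Fin n → ℕ)
         → IsPartialCD G S χS
         → (∀ j → T (S (m j)))
         → (ℓ* : ℕ) → IsOptimalValue (matA G m comp) (vecB m comp S) ℓ*
         → (ℓ : ℕ)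
         → (∃[ χ ] (IsDisjointExtension G S χS χ × numColors χ Data.Nat.≤ ℓ))
           ⇔ (+ ℓ* ≤ + ℓ - + numColorsOn S χS)
lemma1 G m comp _ tc lab noIsolated S χS pcd M⊆S ℓ* optimal ℓ =
  ⇔.trans (disjointExtension⇔ tc lab pcd M⊆S noIsolated optimal ℓ) (⇔.sym (n≤o-m⇔m+n≤o _ ℓ* ℓ))
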